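{- Let $T$ be a caterpillar whose spine contains $k\ge1$ vertices. Then $\varphi(T)=k+2$.
   Context: A caterpillar is a tree whose non-leaf vertices form a path, called the spine. Two sets overlap if they intersect and neither is a subset of the other. An overlap representation of a graph $G=(V,E)$ is a family (multiset) of sets $\{S_v : v\in V\}$ such that for all $u,v\in V$, $(u,v)\in E$ iff $S_u\cap S_v\neq\emptyset$, $S_u\not\subseteq S_v$ and $S_v\not\subseteq S_u$; its size is $|\bigcup_{v} S_v|$, and the overlap number $\varphi(G)$ is the minimum size of an overlap representation of $G$. -}

module Defs where

open import Level using (0ℓ)
open import Data.Nat using (ℕ; suc; _+_; _≤_)
open import Data.Fin using (Fin; toℕ)
open import Data.Fin.Subset using (Subset; _∩_; _⊆_; Nonempty; ⋃; ∣_∣)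
open import Data.List using (List; tabulate)
open import Data.Product using (Σ; ∃; ∃-syntax; _×_; _,_)
open import Data.Sum using (_⊎_)
open import Relation.Nullary using (¬_)
open import Relation.Binary.PropositionalEquality using (_≡_; _≢_)
open import Function.Bundles using (_⇔_)
open import Function.Definitions using (Injective)

record Graph (n : ℕ) : Set₁ where
  field
    Adj   : Fin n → Fin n → Set
    sym   : ∀ {u v} → Adj u v → Adj v u
    irref : ∀ {u} → ¬ Adj u u
open Graph public

data Reach {n : ℕ} (G : Graph n) : Fin n → Fin n → Set where
  here : ∀ {u} → Reach G u u
  step : ∀ {u w v} → Adj G u w → Reach G w v → Reach G u v

Connected : ∀ {n} → Graph n → Set
Connected G = ∀ u v → Reach G u v

IsCycle : ∀ {n} → Graph n → (m : ℕ) → (Fin m → Fin n) → Set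
IsCycle {n} G m c =
  3 ≤ m × Injective _≡_ _≡_ c
  × (∀ (i j : Fin m) → suc (toℕ i) ≡ toℕ j → Adj G (c i) (c j))
  × (∀ (i j : Fin m) → toℕ i ≡ 0 → suc (toℕ j) ≡ m → Adj G (c j) (c i))

Acyclic : ∀ {n} → Graph n → Set
Acyclic G = ∀ m c → ¬ IsCycle G m c

IsTree : ∀ {n} → Graph n → Set
IsTree G = Connected G × Acyclic G

NonLeaf : ∀ {n} → Graph n → Fin n → Set
NonLeaf G v = ∃[ u ] ∃[ w ] (u ≢ w × Adj G v u × Adj G v w)

IsInducedPath : ∀ {n} → Graph n → (k : ℕ) → (Fin k → Fin n) → Set
IsInducedPath G k p =
  Injective _≡_ _≡_ p
  × (∀ (i j : Fin k) → Adj G (p i) (p j) ⇔ (suc (toℕ i) ≡ toℕ j ⊎ suc (toℕ j) ≡ toℕ i))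

IsSpine : ∀ {n} → Graph n → (k : ℕ) → (Fin k → Fin n) → Set
IsSpine G k p = IsInducedPath G k p × (∀ v → NonLeaf G v ⇔ (∃[ i ] p i ≡ v))

CaterpillarWithSpine : ∀ {n} → Graph n → ℕ → Set
CaterpillarWithSpine {n} G k = IsTree G × Σ (Fin k → Fin n) (IsSpine G k)

Overlap : ∀ {m} → Subset m → Subset m → Set
Overlap A B = Nonempty (A ∩ B) × ¬ (A ⊆ B) × ¬ (B ⊆ A)

IsOverlapRep : ∀ {n m} → Graph n → (Fin n → Subset m) → Set
IsOverlapRep G S = ∀ u v → Adj G u v ⇔ Overlap (S u) (S v)

repSize : ∀ {n m} → (Fin n → Subset m) → ℕ
repSize {n} S = ∣ ⋃ (tabulate S) ∣

OverlapNumber : ∀ {n} → Graph n → ℕ → Set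
OverlapNumber {n} G s =
  (∃[ m ] Σ (Fin n → Subset m) λ S → IsOverlapRep G S × repSize S ≡ s)
  × (∀ m (S : Fin n → Subset m) → IsOverlapRep G S → s ≤ repSize S)

module Submission where

-- Upper bound: on the ground set {0, …, k+1}, give the i-th spine vertex the set {i+1, i+2} and a
-- leaf hanging at spine vertex j the set {0, …, j+1}.  Consecutive spine sets overlap, a leaf set
-- overlaps exactly the set of its neighbour, and leaf sets are pairwise nested.
--
-- Lower bound: the spine with one leaf added at each end is an induced path on k+2 vertices, and an
-- overlap representation S 0, …, S (N-1) of an induced path with N ≥ 3 needs N points.  Sets at
-- distance at least 2 are disjoint or nested, and if the last set contains one earlier far set it
-- contains all of them.  If S (N-1) contains a far set, the path without it (with
-- S (N-2) cut down to S (N-2) ∩ S (N-1)) lives inside S (N-1), which misses a point of S (N-2).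
-- Otherwise every far set avoids or contains S (N-1), and deleting all points of S (N-1) except one
-- shared with S (N-2) represents the shorter path on fewer points.  The remaining degenerate
-- configurations are handled by the stronger bound N+1 for paths whose last set has a point that
-- lies in no earlier set.

open import Defs hiding (sym)
open import Data.Nat using (ℕ; zero; suc; _+_; _≤_; _<_; z≤n; s≤s)
open import Data.Nat.Properties
  using (≤-refl; ≤-trans; <-trans; n≤1+n; m≤n⇒m≤1+n; 1+n≰n; m+n≤o⇒n≤o; anyUpTo?)
import Data.Nat.Properties as ℕ
open import Data.Fin using (Fin; zero; suc; toℕ; fromℕ; fromℕ<)
open import Data.Fin.Properties
  using (¬∀⟶∃¬; any?; _≟_; toℕ-injective; toℕ-fromℕ; toℕ-fromℕ<; fromℕ<-toℕ; toℕ<n)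
open import Data.Fin.Subset
open import Data.Fin.Subset.Properties
open import Data.Product using (∃-syntax; _×_; _,_; proj₁; proj₂; swap)
open import Data.Sum using (_⊎_; inj₁; inj₂)
import Data.Sum
open import Data.Vec using (_∷_; here; there; tabulate)
open import Data.Vec.Properties using (lookup∘tabulate; lookup⇒[]=; []=⇒lookup)
open import Function using (_∘_)
open import Function.Bundles using (_⇔_; mk⇔; Equivalence)
open import Function.Definitions using (Injective)
import Data.List as List
open import Data.Empty using (⊥-elim)
open import Relation.Nullary using (¬_; Dec; yes; no)
open import Relation.Nullary.Decidable using (_→-dec_; _⊎-dec_; does; dec-true)
open import Relation.Unary using (Decidable)
open import Relation.Binary.PropositionalEquality using (_≡_; refl; sym; trans; cong; subst; subst₂)

-- Overlapping subsets

x∈p─q⇒x∉q : ∀ {m} {p q : Subset m} {x} → x ∈ p ─ q → x ∉ q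
x∈p─q⇒x∉q {p = _ ∷ _} {outside ∷ _} here ()
x∈p─q⇒x∉q {p = inside ∷ _} {inside ∷ _} () here
x∈p─q⇒x∉q {p = outside ∷ _} {inside ∷ _} () here
x∈p─q⇒x∉q {p = _ ∷ _} {_ ∷ _} (there x∈p─q) (there x∈q) = x∈p─q⇒x∉q x∈p─q x∈q

x∉p⇒x∉p-y : ∀ {m} {p : Subset m} {x y} → x ∉ p → x ∉ p - y
x∉p⇒x∉p-y {p = p} {y = y} x∉p x∈p-y = x∉p (p─q⊆p p ⁅ y ⁆ x∈p-y)

x∉p-x : ∀ {m} (p : Subset m) x → x ∉ p - x
x∉p-x p x x∈p-x = x∈p─q⇒x∉q x∈p-x (x∈⁅x⁆ x)

module _ {m : ℕ} where

  ⊈⇒∃ : {A B : Subset m} → ¬ (A ⊆ B) → ∃[ x ] x ∈ A × x ∉ B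
  ⊈⇒∃ {A} {B} A⊈B
    with ¬∀⟶∃¬ m (λ x → x ∈ A → x ∈ B) (λ x → x ∈? A →-dec x ∈? B) (λ A⊆B → A⊈B (A⊆B _))
  ... | x , x∉A⇒B with x ∈? A
  ...   | yes x∈A = x , x∈A , λ x∈B → x∉A⇒B (λ _ → x∈B)
  ...   | no x∉A = ⊥-elim (x∉A⇒B (λ x∈A → ⊥-elim (x∉A x∈A)))

  p⊆q⇒p─r⊆q─r : {A W D : Subset m} → A ⊆ W → A ─ D ⊆ W ─ D
  p⊆q⇒p─r⊆q─r {A} {W} {D} A⊆W x∈A─D = x∈p∧x∉q⇒x∈p─q (A⊆W (p─q⊆p A D x∈A─D)) (x∈p─q⇒x∉q x∈A─D)

  overlap-⊈ : {A B : Subset m} → Overlap A B → ¬ (A ⊆ B)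
  overlap-⊈ (_ , A⊈B , _) = A⊈B

  overlap-⊉ : {A B : Subset m} → Overlap A B → ¬ (B ⊆ A)
  overlap-⊉ (_ , _ , B⊈A) = B⊈A

  overlap-shared : {A B : Subset m} → Overlap A B → ∃[ x ] x ∈ A × x ∈ B
  overlap-shared ((x , x∈A∩B) , _) = x , x∈p∩q⁻ _ _ x∈A∩B

  overlap-onlyˡ : {A B : Subset m} → Overlap A B → ∃[ x ] x ∈ A × x ∉ B
  overlap-onlyˡ ov = ⊈⇒∃ (overlap-⊈ ov)

  overlap-onlyʳ : {A B : Subset m} → Overlap A B → ∃[ x ] x ∈ B × x ∉ A
  overlap-onlyʳ ov = ⊈⇒∃ (overlap-⊉ ov)

  overlap⁺ : {A B : Subset m} {x y z : Fin m} →
             x ∈ A → x ∈ B → y ∈ A → y ∉ B → z ∈ B → z ∉ A → Overlap A B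
  overlap⁺ x∈A x∈B y∈A y∉B z∈B z∉A =
    (_ , x∈p∩q⁺ (x∈A , x∈B)) , (λ A⊆B → y∉B (A⊆B y∈A)) , (λ B⊆A → z∉A (B⊆A z∈B))

  overlap-sym : {A B : Subset m} → Overlap A B → Overlap B A
  overlap-sym ((x , x∈A∩B) , A⊈B , B⊈A) = (x , x∈p∩q⁺ (swap (x∈p∩q⁻ _ _ x∈A∩B))) , B⊈A , A⊈B

  overlap-irrefl : {A : Subset m} → ¬ Overlap A A
  overlap-irrefl ov = overlap-⊈ ov ⊆-refl

  ¬overlap⇒nested : {A B : Subset m} {x : Fin m} →
                    ¬ Overlap A B → x ∈ A → x ∈ B → A ⊆ B ⊎ B ⊆ A
  ¬overlap⇒nested {A} {B} ¬ov x∈A x∈B with A ⊆? B | B ⊆? A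
  ... | yes A⊆B | _       = inj₁ A⊆B
  ... | no _    | yes B⊆A = inj₂ B⊆A
  ... | no A⊈B  | no B⊈A  = ⊥-elim (¬ov ((_ , x∈p∩q⁺ (x∈A , x∈B)) , A⊈B , B⊈A))

  ⊆-along-overlap : {A B K : Subset m} → Overlap A B → ¬ Overlap B K → A ⊆ K → B ⊆ K
  ⊆-along-overlap ov ¬ov A⊆K with overlap-shared ov
  ... | _ , x∈A , x∈B with ¬overlap⇒nested ¬ov x∈B (A⊆K x∈A)
  ...   | inj₁ B⊆K = B⊆K
  ...   | inj₂ K⊆B = ⊥-elim (overlap-⊈ ov (λ x∈A → K⊆B (A⊆K x∈A)))

  overlap-─⁻ : {A B D : Subset m} → Overlap (A ─ D) (B ─ D) → Overlap A B
  overlap-─⁻ {A} {B} {D} ov with overlap-shared ov | overlap-onlyˡ ov | overlap-onlyʳ ov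
  ... | _ , x∈A─D , x∈B─D | _ , y∈A─D , y∉B─D | _ , z∈B─D , z∉A─D =
    overlap⁺ (p─q⊆p A D x∈A─D) (p─q⊆p B D x∈B─D)
             (p─q⊆p A D y∈A─D) (λ y∈B → y∉B─D (x∈p∧x∉q⇒x∈p─q y∈B (x∈p─q⇒x∉q y∈A─D)))
             (p─q⊆p B D z∈B─D) (λ z∈A → z∉A─D (x∈p∧x∉q⇒x∈p─q z∈A (x∈p─q⇒x∉q z∈B─D)))

  overlap-∩⁻ : {A B X : Subset m} → B ⊆ X → Overlap (A ∩ X) B → Overlap A B
  overlap-∩⁻ {A} {B} {X} B⊆X ov with overlap-shared ov | overlap-onlyˡ ov | overlap-onlyʳ ov
  ... | _ , x∈A∩X , x∈B | _ , y∈A∩X , y∉B | _ , z∈B , z∉A∩X =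
    overlap⁺ (p∩q⊆p A X x∈A∩X) x∈B (p∩q⊆p A X y∈A∩X) y∉B
             z∈B (λ z∈A → z∉A∩X (x∈p∩q⁺ (z∈A , B⊆X z∈B)))

  overlap⇒3≤∣∣ : {A B W : Subset m} → Overlap A B → A ⊆ W → B ⊆ W → 3 ≤ ∣ W ∣
  overlap⇒3≤∣∣ {A} {B} {W} ov A⊆W B⊆W
    with overlap-shared ov | overlap-onlyˡ ov | overlap-onlyʳ ov
  ... | x , x∈A , x∈B | y , y∈A , y∉B | z , z∈B , z∉A =
    ≤-trans (s≤s (s≤s (s≤s z≤n)))
      (≤-trans (s≤s (s≤s (x∈p⇒∣p-x∣<∣p∣ x∈W-z-y)))
        (≤-trans (s≤s (x∈p⇒∣p-x∣<∣p∣ y∈W-z)) (x∈p⇒∣p-x∣<∣p∣ (B⊆W z∈B))))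
    where
    y∈W-z = x∈p∧x≢y⇒x∈p-y (A⊆W y∈A) (λ { refl → z∉A y∈A })
    x∈W-z-y = x∈p∧x≢y⇒x∈p-y (x∈p∧x≢y⇒x∈p-y (A⊆W x∈A) (λ { refl → z∉A x∈A }))
                            (λ { refl → y∉B x∈B })

  AvoidsOrContains : Subset m → Subset m → Set
  AvoidsOrContains K A = (∀ {x} → x ∈ A → x ∉ K) ⊎ K ⊆ A

  ¬overlap∧⊈⇒avoidsOrContains : {A K : Subset m} → ¬ Overlap A K → ¬ (A ⊆ K) → AvoidsOrContains K A
  ¬overlap∧⊈⇒avoidsOrContains {A} {K} ¬ov A⊈K with nonempty? (A ∩ K)
  ... | no A∩K≡∅ = inj₁ (λ x∈A x∈K → A∩K≡∅ (_ , x∈p∩q⁺ (x∈A , x∈K)))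
  ... | yes (_ , x∈A∩K) with ¬overlap⇒nested ¬ov (p∩q⊆p A K x∈A∩K) (p∩q⊆q A K x∈A∩K)
  ...   | inj₁ A⊆K = ⊥-elim (A⊈K A⊆K)
  ...   | inj₂ K⊆A = inj₂ K⊆A

  overlap-─⁺ : {A B D : Subset m} →
               ∃[ x ] x ∈ A × x ∈ B × x ∉ D → ∃[ y ] y ∈ A × y ∉ B × y ∉ D →
               ∃[ z ] z ∈ B × z ∉ A × z ∉ D → Overlap (A ─ D) (B ─ D)
  overlap-─⁺ {A} {B} {D} (_ , x∈A , x∈B , x∉D) (_ , y∈A , y∉B , y∉D) (_ , z∈B , z∉A , z∉D) =
    overlap⁺ (x∈p∧x∉q⇒x∈p─q x∈A x∉D) (x∈p∧x∉q⇒x∈p─q x∈B x∉D)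
             (x∈p∧x∉q⇒x∈p─q y∈A y∉D) (λ y∈B─D → y∉B (p─q⊆p B D y∈B─D))
             (x∈p∧x∉q⇒x∈p─q z∈B z∉D) (λ z∈A─D → z∉A (p─q⊆p A D z∈A─D))

  module _ {K : Subset m} {t : Fin m} (t∈K : t ∈ K) where

    private
      shared : {A B : Subset m} → Overlap A B → AvoidsOrContains K A → AvoidsOrContains K B →
               ∃[ x ] x ∈ A × x ∈ B × x ∉ K - t
      shared ov (inj₁ A∩K≡∅) _ with overlap-shared ov
      ... | x , x∈A , x∈B = x , x∈A , x∈B , x∉p⇒x∉p-y (A∩K≡∅ x∈A)
      shared ov (inj₂ _) (inj₁ B∩K≡∅) with overlap-shared ov
      ... | x , x∈A , x∈B = x , x∈A , x∈B , x∉p⇒x∉p-y (B∩K≡∅ x∈B)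
      shared ov (inj₂ K⊆A) (inj₂ K⊆B) = t , K⊆A t∈K , K⊆B t∈K , (x∉p-x K t)

      onlyˡ : {A B : Subset m} → Overlap A B → AvoidsOrContains K A → AvoidsOrContains K B →
              ∃[ y ] y ∈ A × y ∉ B × y ∉ K - t
      onlyˡ ov _ (inj₂ K⊆B) with overlap-onlyˡ ov
      ... | y , y∈A , y∉B = y , y∈A , y∉B , x∉p⇒x∉p-y (λ y∈K → y∉B (K⊆B y∈K))
      onlyˡ ov (inj₁ A∩K≡∅) (inj₁ _) with overlap-onlyˡ ov
      ... | y , y∈A , y∉B = y , y∈A , y∉B , x∉p⇒x∉p-y (A∩K≡∅ y∈A)
      onlyˡ ov (inj₂ K⊆A) (inj₁ B∩K≡∅) = t , K⊆A t∈K , (λ t∈B → B∩K≡∅ t∈B t∈K) , (x∉p-x K t)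

    overlap-─-point : {A B : Subset m} → AvoidsOrContains K A → AvoidsOrContains K B →
                      Overlap A B → Overlap (A ─ (K - t)) (B ─ (K - t))
    overlap-─-point KA KB ov =
      overlap-─⁺ (shared ov KA KB) (onlyˡ ov KA KB) (onlyˡ (overlap-sym ov) KB KA)

  ≤∣p∣⇒<∣q∣ : {A W : Subset m} {k : ℕ} {w : Fin m} → A ⊆ W → w ∈ W → w ∉ A →
             k ≤ ∣ A ∣ → suc k ≤ ∣ W ∣
  ≤∣p∣⇒<∣q∣ A⊆W w∈W w∉A k≤∣A∣ = ≤-trans (s≤s k≤∣A∣) (p⊂q⇒∣p∣<∣q∣ (A⊆W , _ , w∈W , w∉A))

-- Overlap representations of paths

record IsPath (R : ℕ → ℕ → Set) (N : ℕ) : Set where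
  field
    edge⇒adjacent : ∀ {i j} → i < N → j < N → R i j → suc i ≡ j ⊎ suc j ≡ i
    adjacent⇒edge : ∀ {i} → suc i < N → R i (suc i)

  prefix : ∀ {M} → M ≤ N → IsPath R M
  prefix M≤N = record
    { edge⇒adjacent = λ i<M j<M → edge⇒adjacent (≤-trans i<M M≤N) (≤-trans j<M M≤N)
    ; adjacent⇒edge = λ i+1<M → adjacent⇒edge (≤-trans i+1<M M≤N)
    }

  far⇒¬edge : ∀ {l k} → k < N → 2 + l ≤ k → ¬ R l k
  far⇒¬edge {l} k<N l+2≤k e with edge⇒adjacent (<-trans (m+n≤o⇒n≤o 1 l+2≤k) k<N) k<N e
  ... | inj₁ refl = 1+n≰n l+2≤k
  ... | inj₂ refl = 1+n≰n (m+n≤o⇒n≤o 2 l+2≤k)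

open IsPath

module _ {m : ℕ} where

  OverlapPath : ℕ → (ℕ → Subset m) → Set
  OverlapPath N S = IsPath (λ i j → Overlap (S i) (S j)) N

  Within : ℕ → (ℕ → Subset m) → Subset m → Set
  Within N S W = ∀ {l} → l < N → S l ⊆ W

  Fresh : (ℕ → Subset m) → ℕ → Fin m → Set
  Fresh S k y = ∀ {l} → l < k → y ∉ S l

  module _ {N : ℕ} {S : ℕ → Subset m} (P : OverlapPath N S) {k : ℕ} (k<N : k < N) where

    far-⊆-spread : ∀ {l₀} → 2 + l₀ ≤ k → S l₀ ⊆ S k → ∀ {l} → 2 + l ≤ k → S l ⊆ S k
    far-⊆-spread {l₀} l₀+2≤k S₀⊆Sk l+2≤k = up-from-0 _ l+2≤k (down-to-0 l₀ l₀+2≤k S₀⊆Sk)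
      where
      up : ∀ {l} → 3 + l ≤ k → S l ⊆ S k → S (suc l) ⊆ S k
      up l+3≤k = ⊆-along-overlap (adjacent⇒edge P (<-trans (m+n≤o⇒n≤o 1 l+3≤k) k<N))
                                 (far⇒¬edge P k<N l+3≤k)

      down : ∀ {l} → 3 + l ≤ k → S (suc l) ⊆ S k → S l ⊆ S k
      down l+3≤k = ⊆-along-overlap (overlap-sym (adjacent⇒edge P (<-trans (m+n≤o⇒n≤o 1 l+3≤k) k<N)))
                                   (far⇒¬edge P k<N (m+n≤o⇒n≤o 1 l+3≤k))

      down-to-0 : ∀ l → 2 + l ≤ k → S l ⊆ S k → S 0 ⊆ S k
      down-to-0 zero    _      S₀⊆Sk = S₀⊆Sk
      down-to-0 (suc l) l+3≤k Sl⊆Sk = down-to-0 l (m+n≤o⇒n≤o 1 l+3≤k) (down l+3≤k Sl⊆Sk)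

      up-from-0 : ∀ l → 2 + l ≤ k → S 0 ⊆ S k → S l ⊆ S k
      up-from-0 zero    _      S₀⊆Sk = S₀⊆Sk
      up-from-0 (suc l) l+3≤k S₀⊆Sk = up l+3≤k (up-from-0 l (m+n≤o⇒n≤o 1 l+3≤k) S₀⊆Sk)

  _[_]≔_ : (ℕ → Subset m) → ℕ → Subset m → ℕ → Subset m
  (S [ k ]≔ A) i with i ℕ.≟ k
  ... | yes _ = A
  ... | no _  = S i

  module ShrinkLast {k : ℕ} {S : ℕ → Subset m} {X : Subset m} (P : OverlapPath (2 + k) S)
                    (within : Within (suc k) S X) (ov : Overlap (S k) (S (suc k) ∩ X)) where

    Q : ℕ → Subset m
    Q = S [ suc k ]≔ (S (suc k) ∩ X)

    Q-last : Q (suc k) ≡ S (suc k) ∩ X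
    Q-last with suc k ℕ.≟ suc k
    ... | yes _ = refl
    ... | no k≢k = ⊥-elim (k≢k refl)

    Q-below : ∀ {i} → i < suc k → Q i ≡ S i
    Q-below {i} i<k+1 with i ℕ.≟ suc k
    ... | yes refl = ⊥-elim (1+n≰n i<k+1)
    ... | no _ = refl

    overlap⁻ : ∀ {i j} → i < 2 + k → j < 2 + k → Overlap (Q i) (Q j) → Overlap (S i) (S j)
    overlap⁻ {i} {j} i<k+2 j<k+2 ov with i ℕ.≟ suc k | j ℕ.≟ suc k
    ... | yes refl | yes refl = ⊥-elim (overlap-irrefl ov)
    ... | yes refl | no j≢k+1 = overlap-∩⁻ (within (ℕ.≤∧≢⇒< (ℕ.≤-pred j<k+2) j≢k+1)) ov
    ... | no i≢k+1 | yes refl =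
      overlap-sym (overlap-∩⁻ (within (ℕ.≤∧≢⇒< (ℕ.≤-pred i<k+2) i≢k+1)) (overlap-sym ov))
    ... | no _     | no _     = ov

    adjacent⇒overlap : ∀ {i} → suc i < 2 + k → Overlap (Q i) (Q (suc i))
    adjacent⇒overlap {i} i+1<k+2 with i ℕ.≟ suc k | suc i ℕ.≟ suc k
    ... | yes refl | _        = ⊥-elim (1+n≰n (ℕ.≤-pred i+1<k+2))
    ... | no _     | yes refl = ov
    ... | no _     | no _     = adjacent⇒edge P i+1<k+2

    path : OverlapPath (2 + k) Q
    path = record
      { edge⇒adjacent = λ i< j< ov → edge⇒adjacent P i< j< (overlap⁻ i< j< ov)
      ; adjacent⇒edge = adjacent⇒overlap
      }

    Q-within : Within (2 + k) Q X
    Q-within {i} i<k+2 with i ℕ.≟ suc k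
    ... | yes refl = p∩q⊆q (S (suc k)) X
    ... | no i≢k+1 = within (ℕ.≤∧≢⇒< (ℕ.≤-pred i<k+2) i≢k+1)

  fresh-propagates : ∀ n {S : ℕ → Subset m} {y} → OverlapPath (3 + n) S →
                     y ∈ S (2 + n) → Fresh S (2 + n) y → ∃[ y′ ] y′ ∈ S (1 + n) × Fresh S (1 + n) y′
  fresh-propagates n {S} P y∈ y-fresh with overlap-shared (adjacent⇒edge P ≤-refl)
  ... | z , z∈Sₚ , z∈Sₗ with anyUpTo? (λ l → z ∈? S l) (1 + n)
  ...   | no z-fresh = z , z∈Sₚ , λ l< z∈Sl → z-fresh (_ , l< , z∈Sl)
  ...   | yes (l , l< , z∈Sl) with ¬overlap⇒nested (far⇒¬edge P ≤-refl (s≤s l<)) z∈Sl z∈Sₗ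
  ...     | inj₂ Sₗ⊆Sl = ⊥-elim (y-fresh (m≤n⇒m≤1+n l<) (Sₗ⊆Sl y∈))
  ...     | inj₁ Sl⊆Sₗ with overlap-onlyˡ (adjacent⇒edge P ≤-refl)
  ...       | w , w∈Sₚ , w∉Sₗ =
    w , w∈Sₚ , λ l′< w∈ → w∉Sₗ (far-⊆-spread P ≤-refl (s≤s l<) Sl⊆Sₗ (s≤s l′<) w∈)

  fresh-end⇒size : ∀ n {S W y} → OverlapPath (2 + n) S → y ∈ S (1 + n) → Fresh S (1 + n) y →
                   Within (2 + n) S W → 3 + n ≤ ∣ W ∣
  fresh-end⇒size zero P _ _ within =
    overlap⇒3≤∣∣ (adjacent⇒edge P ≤-refl) (within (s≤s z≤n)) (within ≤-refl)
  fresh-end⇒size (suc n) {S} {W} {y} P y∈ y-fresh within with fresh-propagates n P y∈ y-fresh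
  ... | y′ , y′∈ , y′-fresh =
    ≤-trans (s≤s (fresh-end⇒size n (prefix P (n≤1+n _)) y′∈ y′-fresh within-W-y))
            (x∈p⇒∣p-x∣<∣p∣ (within ≤-refl y∈))
    where
    within-W-y : Within (2 + n) S (W - y)
    within-W-y l< x∈ = x∈p∧x≢y⇒x∈p-y (within (m≤n⇒m≤1+n l<) x∈) (λ { refl → y-fresh l< x∈ })

  -- Variable names S₀, S₁, S₂ refer to S e₀, S e₁, S e₂, where e₀ is the last index.
  module PathStep (n : ℕ) {S : ℕ → Subset m} {W : Subset m}
                  (P : OverlapPath (4 + n) S) (within : Within (4 + n) S W)
                  (ih : ∀ {S′ W′} → OverlapPath (3 + n) S′ → Within (3 + n) S′ W′ → 3 + n ≤ ∣ W′ ∣)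
                  where

    e₀ e₁ e₂ : ℕ
    e₀ = 3 + n
    e₁ = 2 + n
    e₂ = 1 + n

    e₁<N : e₁ < 4 + n
    e₁<N = n≤1+n _

    ov₁₀ : Overlap (S e₁) (S e₀)
    ov₁₀ = adjacent⇒edge P ≤-refl

    ov₂₁ : Overlap (S e₂) (S e₁)
    ov₂₁ = adjacent⇒edge P e₁<N

    ovₙ₂ : Overlap (S n) (S e₂)
    ovₙ₂ = adjacent⇒edge P (≤-trans (n≤1+n _) e₁<N)

    module SomeFarInsideLast {l : ℕ} (l<e₁ : l < e₁) (Sl⊆S₀ : S l ⊆ S e₀) where

      inside₀ : ∀ {l′} → 2 + l′ ≤ e₀ → S l′ ⊆ S e₀
      inside₀ = far-⊆-spread P ≤-refl (s≤s l<e₁) Sl⊆S₀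

      within₀ : Within e₁ S (S e₀)
      within₀ l′< = inside₀ (s≤s l′<)

      shrink : ¬ (S e₁ ∩ S e₀ ⊆ S e₂) → 3 + n ≤ ∣ S e₀ ∣
      shrink S₁₀⊈S₂ = ih path Q-within
        where
        ov : Overlap (S e₂) (S e₁ ∩ S e₀)
        ov with overlap-shared ov₂₁ | overlap-onlyˡ ov₂₁ | ⊈⇒∃ S₁₀⊈S₂
        ... | _ , x∈S₂ , x∈S₁ | _ , y∈S₂ , y∉S₁ | _ , z∈S₁₀ , z∉S₂ =
          overlap⁺ x∈S₂ (x∈p∩q⁺ (x∈S₁ , inside₀ ≤-refl x∈S₂))
                   y∈S₂ (λ y∈S₁₀ → y∉S₁ (p∩q⊆p _ _ y∈S₁₀)) z∈S₁₀ z∉S₂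
        open ShrinkLast (prefix P (n≤1+n _)) within₀ ov

      fresh : S e₁ ∩ S e₀ ⊆ S e₂ → 3 + n ≤ ∣ S e₀ ∣
      fresh S₁₀⊆S₂ with overlap-shared ov₁₀
      ... | x , x∈S₁ , x∈S₀ =
        fresh-end⇒size n (prefix P (≤-trans (n≤1+n _) e₁<N)) (S₁₀⊆S₂ (x∈p∩q⁺ (x∈S₁ , x∈S₀)))
                       x-fresh within₀
        where
        x-fresh : Fresh S e₂ x
        x-fresh l′< x∈Sl′ with ¬overlap⇒nested (far⇒¬edge P e₁<N (s≤s l′<)) x∈Sl′ x∈S₁
        ... | inj₁ Sl′⊆S₁ =
          overlap-⊈ ovₙ₂ λ y∈Sn →
            S₁₀⊆S₂ (x∈p∩q⁺ (far-⊆-spread P e₁<N (s≤s l′<) Sl′⊆S₁ ≤-refl y∈Sn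
                           , inside₀ (n≤1+n _) y∈Sn))
        ... | inj₂ S₁⊆Sl′ = overlap-⊈ ov₁₀ (λ y∈S₁ → inside₀ (s≤s (m≤n⇒m≤1+n l′<)) (S₁⊆Sl′ y∈S₁))

      bound : 3 + n ≤ ∣ S e₀ ∣
      bound with S e₁ ∩ S e₀ ⊆? S e₂
      ... | yes S₁₀⊆S₂ = fresh S₁₀⊆S₂
      ... | no S₁₀⊈S₂ = shrink S₁₀⊈S₂

    module NoFarInsideLast (S⊈S₀ : ∀ {l} → l < e₁ → ¬ (S l ⊆ S e₀)) where

      aligned : ∀ {l} → l < e₁ → AvoidsOrContains (S e₀) (S l)
      aligned l< = ¬overlap∧⊈⇒avoidsOrContains (far⇒¬edge P ≤-refl (s≤s l<)) (S⊈S₀ l<)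

      cut : ¬ (S e₀ ⊆ S e₂ × S e₂ ─ S e₁ ⊆ S e₀) → 4 + n ≤ ∣ W ∣
      cut ¬both with overlap-shared ov₁₀ | overlap-onlyʳ ov₁₀
      ... | t , t∈S₁ , t∈S₀ | t′ , t′∈S₀ , t′∉S₁ =
        ≤∣p∣⇒<∣q∣ (p─q⊆p W D) (within ≤-refl t′∈S₀) (λ t′∈W─D → x∈p─q⇒x∉q t′∈W─D t′∈D)
                 (ih path (λ l< → p⊆q⇒p─r⊆q─r (within (m≤n⇒m≤1+n l<))))
        where
        D : Subset m
        D = S e₀ - t

        t′∈D : t′ ∈ D
        t′∈D = x∈p∧x≢y⇒x∈p-y t′∈S₀ (λ { refl → t′∉S₁ t∈S₁ })

        -- S e₁ is the one set that neither avoids nor contains S e₀.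
        last-edge : Overlap (S e₂ ─ D) (S e₁ ─ D)
        last-edge with aligned {e₂} ≤-refl
        ... | inj₁ S₂∩S₀≡∅ with overlap-shared ov₂₁ | overlap-onlyˡ ov₂₁
        ...   | x , x∈S₂ , x∈S₁ | y , y∈S₂ , y∉S₁ =
          overlap-─⁺ (x , x∈S₂ , x∈S₁ , x∉p⇒x∉p-y (S₂∩S₀≡∅ x∈S₂))
                     (y , y∈S₂ , y∉S₁ , x∉p⇒x∉p-y (S₂∩S₀≡∅ y∈S₂))
                     (t , t∈S₁ , (λ t∈S₂ → S₂∩S₀≡∅ t∈S₂ t∈S₀) , x∉p-x (S e₀) t)
        last-edge | inj₂ S₀⊆S₂ with ⊈⇒∃ (λ S₂─S₁⊆S₀ → ¬both (S₀⊆S₂ , S₂─S₁⊆S₀)) | overlap-onlyʳ ov₂₁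
        ...   | y , y∈S₂─S₁ , y∉S₀ | z , z∈S₁ , z∉S₂ =
          overlap-─⁺ (t , S₀⊆S₂ t∈S₀ , t∈S₁ , x∉p-x (S e₀) t)
                     (y , p─q⊆p _ _ y∈S₂─S₁ , x∈p─q⇒x∉q y∈S₂─S₁ , x∉p⇒x∉p-y y∉S₀)
                     (z , z∈S₁ , z∉S₂ , x∉p⇒x∉p-y (λ z∈S₀ → z∉S₂ (S₀⊆S₂ z∈S₀)))

        adjacent⇒overlap : ∀ {i} → suc i < 3 + n → Overlap (S i ─ D) (S (suc i) ─ D)
        adjacent⇒overlap {i} i+1<e₀ with suc i ℕ.≟ e₁
        ... | yes refl = last-edge
        ... | no i+1≢e₁ =
          overlap-─-point t∈S₀ (aligned (<-trans (ℕ.n<1+n i) i+1<e₁)) (aligned i+1<e₁)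
                          (adjacent⇒edge P (m≤n⇒m≤1+n i+1<e₀))
          where
          i+1<e₁ : suc i < e₁
          i+1<e₁ = ℕ.≤∧≢⇒< (ℕ.≤-pred i+1<e₀) i+1≢e₁

        path : OverlapPath (3 + n) (λ l → S l ─ D)
        path = record
          { edge⇒adjacent = λ i< j< ov → edge⇒adjacent P (m≤n⇒m≤1+n i<) (m≤n⇒m≤1+n j<) (overlap-─⁻ ov)
          ; adjacent⇒edge = adjacent⇒overlap
          }

      fold : S e₀ ⊆ S e₂ → S e₂ ─ S e₁ ⊆ S e₀ → 3 + n ≤ ∣ S e₁ ∣
      fold S₀⊆S₂ S₂─S₁⊆S₀ with overlap-shared ov₁₀
      ... | x , x∈S₁ , x∈S₀ =
        fresh-end⇒size n path (subst (x ∈_) (sym Q-last) (x∈p∩q⁺ (S₀⊆S₂ x∈S₀ , x∈S₁)))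
                       (λ l< x∈Ql → x-fresh l< (subst (x ∈_) (Q-below l<) x∈Ql)) Q-within
        where
        S₂⊆ : ∀ {A} → S e₁ ⊆ A → S e₀ ⊆ A → S e₂ ⊆ A
        S₂⊆ S₁⊆A S₀⊆A {y} y∈S₂ with y ∈? S e₁
        ... | yes y∈S₁ = S₁⊆A y∈S₁
        ... | no y∉S₁ = S₀⊆A (S₂─S₁⊆S₀ (x∈p∧x∉q⇒x∈p─q y∈S₂ y∉S₁))

        S₁⊈Sn : ¬ (S e₁ ⊆ S n)
        S₁⊈Sn S₁⊆Sn with aligned {n} (n≤1+n _)
        ... | inj₁ Sn∩S₀≡∅ = Sn∩S₀≡∅ (S₁⊆Sn x∈S₁) x∈S₀
        ... | inj₂ S₀⊆Sn = overlap-⊉ ovₙ₂ (S₂⊆ S₁⊆Sn S₀⊆Sn)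

        Sn-meets-S₁ : ∃[ c ] c ∈ S n × c ∈ S e₁
        Sn-meets-S₁ with overlap-shared ovₙ₂
        ... | y , y∈Sn , y∈S₂ with y ∈? S e₁
        ...   | yes y∈S₁ = y , y∈Sn , y∈S₁
        ...   | no y∉S₁ with aligned {n} (n≤1+n _)
        ...     | inj₁ Sn∩S₀≡∅ = ⊥-elim (Sn∩S₀≡∅ y∈Sn (S₂─S₁⊆S₀ (x∈p∧x∉q⇒x∈p─q y∈S₂ y∉S₁)))
        ...     | inj₂ S₀⊆Sn = x , S₀⊆Sn x∈S₀ , x∈S₁

        Sn⊆S₁ : S n ⊆ S e₁
        Sn⊆S₁ with Sn-meets-S₁
        ... | c , c∈Sn , c∈S₁ with ¬overlap⇒nested (far⇒¬edge P e₁<N ≤-refl) c∈Sn c∈S₁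
        ...   | inj₁ Sn⊆S₁ = Sn⊆S₁
        ...   | inj₂ S₁⊆Sn = ⊥-elim (S₁⊈Sn S₁⊆Sn)

        inside₁ : ∀ {l} → 2 + l ≤ e₁ → S l ⊆ S e₁
        inside₁ = far-⊆-spread P e₁<N ≤-refl Sn⊆S₁

        x-fresh : Fresh S e₂ x
        x-fresh l< x∈Sl with aligned (m≤n⇒m≤1+n l<)
        ... | inj₁ Sl∩S₀≡∅ = Sl∩S₀≡∅ x∈Sl x∈S₀
        ... | inj₂ S₀⊆Sl = overlap-⊉ ov₁₀ (λ y∈S₀ → inside₁ (s≤s l<) (S₀⊆Sl y∈S₀))

        ov : Overlap (S n) (S e₂ ∩ S e₁)
        ov with overlap-shared ovₙ₂ | overlap-onlyˡ ovₙ₂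
        ... | c , c∈Sn , c∈S₂ | w , w∈Sn , w∉S₂ =
          overlap⁺ c∈Sn (x∈p∩q⁺ (c∈S₂ , Sn⊆S₁ c∈Sn)) w∈Sn (λ w∈S₂₁ → w∉S₂ (p∩q⊆p _ _ w∈S₂₁))
                   (x∈p∩q⁺ (S₀⊆S₂ x∈S₀ , x∈S₁)) (x-fresh ≤-refl)

        open ShrinkLast (prefix P (≤-trans (n≤1+n _) e₁<N)) (λ l< → inside₁ (s≤s l<)) ov

      bound : 4 + n ≤ ∣ W ∣
      bound with S e₀ ⊆? S e₂ | S e₂ ─ S e₁ ⊆? S e₀
      ... | yes S₀⊆S₂ | yes S₂─S₁⊆S₀ with overlap-onlyʳ ov₁₀
      ...   | y , y∈S₀ , y∉S₁ =
        ≤∣p∣⇒<∣q∣ (within e₁<N) (within ≤-refl y∈S₀) y∉S₁ (fold S₀⊆S₂ S₂─S₁⊆S₀)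
      bound | no S₀⊈S₂ | _ = cut (λ both → S₀⊈S₂ (proj₁ both))
      bound | yes _ | no S₂─S₁⊈S₀ = cut (λ both → S₂─S₁⊈S₀ (proj₂ both))

    bound : 4 + n ≤ ∣ W ∣
    bound with anyUpTo? (λ l → S l ⊆? S e₀) e₁
    ... | yes (l , l< , Sl⊆S₀) with overlap-onlyˡ ov₁₀
    ...   | y , y∈S₁ , y∉S₀ =
      ≤∣p∣⇒<∣q∣ (within ≤-refl) (within e₁<N y∈S₁) y∉S₀ (SomeFarInsideLast.bound l< Sl⊆S₀)
    bound | no none = NoFarInsideLast.bound (λ l< Sl⊆S₀ → none (_ , l< , Sl⊆S₀))

  path-size : ∀ n {S W} → OverlapPath (3 + n) S → Within (3 + n) S W → 3 + n ≤ ∣ W ∣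
  path-size zero    P within =
    overlap⇒3≤∣∣ (adjacent⇒edge P (n≤1+n _)) (within (s≤s z≤n)) (within (s≤s (s≤s z≤n)))
  path-size (suc n) P within = PathStep.bound n P within (path-size n)

-- Caterpillars

⟦_⟧ : ∀ {m} {P : Fin m → Set} → Decidable P → Subset m
⟦ P? ⟧ = tabulate (does ∘ P?)

∈⟦⟧⁺ : ∀ {m} {P : Fin m → Set} (P? : Decidable P) {x} → P x → x ∈ ⟦ P? ⟧
∈⟦⟧⁺ P? {x} Px = lookup⇒[]= x _ (trans (lookup∘tabulate (does ∘ P?) x) (dec-true (P? x) Px))

∈⟦⟧⁻ : ∀ {m} {P : Fin m → Set} (P? : Decidable P) {x} → x ∈ ⟦ P? ⟧ → P x
∈⟦⟧⁻ P? {x} x∈ with P? x | trans (sym (lookup∘tabulate (does ∘ P?) x)) ([]=⇒lookup x∈)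
... | yes Px | _ = Px
... | no _   | ()

module SpineSets (K : ℕ) where

  pair? : ∀ i → Decidable (λ (x : Fin (2 + K)) → toℕ x ≡ suc i ⊎ toℕ x ≡ 2 + i)
  pair? i x = toℕ x ℕ.≟ suc i ⊎-dec toℕ x ℕ.≟ 2 + i

  initial? : ∀ j → Decidable (λ (x : Fin (2 + K)) → toℕ x ≤ suc j)
  initial? j x = toℕ x ℕ.≤? suc j

  pair : ℕ → Subset (2 + K)
  pair i = ⟦ pair? i ⟧

  initial : ℕ → Subset (2 + K)
  initial j = ⟦ initial? j ⟧

  ∈pair⁺ : ∀ {i x} → toℕ x ≡ suc i ⊎ toℕ x ≡ 2 + i → x ∈ pair i
  ∈pair⁺ {i} = ∈⟦⟧⁺ (pair? i)

  ∈pair⁻ : ∀ {i x} → x ∈ pair i → toℕ x ≡ suc i ⊎ toℕ x ≡ 2 + i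
  ∈pair⁻ {i} = ∈⟦⟧⁻ (pair? i)

  ∉pair : ∀ {i x} → toℕ x < suc i ⊎ 2 + i < toℕ x → x ∉ pair i
  ∉pair out x∈ with out | ∈pair⁻ x∈
  ... | inj₁ x<i+1 | inj₁ x≡i+1 = ℕ.<⇒≢ x<i+1 x≡i+1
  ... | inj₁ x<i+1 | inj₂ x≡i+2 = ℕ.<⇒≢ (<-trans x<i+1 (ℕ.n<1+n _)) x≡i+2
  ... | inj₂ i+2<x | inj₁ x≡i+1 = ℕ.<⇒≢ (<-trans (ℕ.n<1+n _) i+2<x) (sym x≡i+1)
  ... | inj₂ i+2<x | inj₂ x≡i+2 = ℕ.<⇒≢ i+2<x (sym x≡i+2)

  ∈initial⁺ : ∀ {j x} → toℕ x ≤ suc j → x ∈ initial j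
  ∈initial⁺ {j} = ∈⟦⟧⁺ (initial? j)

  ∈initial⁻ : ∀ {j x} → x ∈ initial j → toℕ x ≤ suc j
  ∈initial⁻ {j} = ∈⟦⟧⁻ (initial? j)

  pair-overlap⇒ : ∀ {i j} → Overlap (pair i) (pair j) → suc i ≡ j ⊎ suc j ≡ i
  pair-overlap⇒ {i} {j} ov with overlap-shared ov
  ... | x , x∈i , x∈j with ∈pair⁻ {i} x∈i | ∈pair⁻ {j} x∈j
  ...   | inj₁ e | inj₁ e′ with refl ← ℕ.suc-injective (trans (sym e) e′) = ⊥-elim (overlap-irrefl ov)
  ...   | inj₁ e | inj₂ e′ = inj₂ (sym (ℕ.suc-injective (trans (sym e) e′)))
  ...   | inj₂ e | inj₁ e′ = inj₁ (ℕ.suc-injective (trans (sym e) e′))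
  ...   | inj₂ e | inj₂ e′ with refl ← ℕ.suc-injective (ℕ.suc-injective (trans (sym e) e′)) =
    ⊥-elim (overlap-irrefl ov)

  pair-overlap-suc : ∀ {i} → suc i < K → Overlap (pair i) (pair (suc i))
  pair-overlap-suc {i} i+1<K =
    overlap⁺ (∈pair⁺ (inj₂ (toℕ-fromℕ< x<))) (∈pair⁺ (inj₁ (toℕ-fromℕ< x<)))
             (∈pair⁺ (inj₁ (toℕ-fromℕ< y<))) (∉pair (inj₁ (subst (_< 2 + i) (sym (toℕ-fromℕ< y<)) ≤-refl)))
             (∈pair⁺ (inj₂ (toℕ-fromℕ< z<))) (∉pair (inj₂ (subst (2 + i <_) (sym (toℕ-fromℕ< z<)) ≤-refl)))
    where
    x< : 2 + i < 2 + K
    x< = ≤-trans (s≤s i+1<K) (n≤1+n _)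
    y< : 1 + i < 2 + K
    y< = <-trans (ℕ.n<1+n _) x<
    z< : 3 + i < 2 + K
    z< = s≤s (s≤s i+1<K)

  pair-overlap⇐ : ∀ {i j} → i < K → j < K → suc i ≡ j ⊎ suc j ≡ i → Overlap (pair i) (pair j)
  pair-overlap⇐ _   j<K (inj₁ refl) = pair-overlap-suc j<K
  pair-overlap⇐ i<K _   (inj₂ refl) = overlap-sym (pair-overlap-suc i<K)

  pair-initial-overlap⇒ : ∀ {i j} → Overlap (pair i) (initial j) → i ≡ j
  pair-initial-overlap⇒ {i} {j} ov@(_ , pair⊈initial , _) with overlap-shared ov
  ... | x , x∈pair , x∈initial with i ℕ.<? j
  ...   | yes i<j = ⊥-elim (pair⊈initial (λ y∈pair → ∈initial⁺ (y≤ (∈pair⁻ y∈pair))))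
    where
    y≤ : ∀ {y} → toℕ y ≡ suc i ⊎ toℕ y ≡ 2 + i → toℕ y ≤ suc j
    y≤ (inj₁ y≡i+1) = subst (_≤ suc j) (sym y≡i+1) (ℕ.m≤n⇒m≤1+n i<j)
    y≤ (inj₂ y≡i+2) = subst (_≤ suc j) (sym y≡i+2) (s≤s i<j)
  ...   | no i≮j = ℕ.≤-antisym (ℕ.≤-pred (≤-trans (x≥ (∈pair⁻ x∈pair)) (∈initial⁻ x∈initial))) (ℕ.≮⇒≥ i≮j)
    where
    x≥ : toℕ x ≡ suc i ⊎ toℕ x ≡ 2 + i → suc i ≤ toℕ x
    x≥ (inj₁ x≡i+1) = ℕ.≤-reflexive (sym x≡i+1)
    x≥ (inj₂ x≡i+2) = subst (suc i ≤_) (sym x≡i+2) (n≤1+n _)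

  pair-initial-overlap : ∀ {i} → i < K → Overlap (pair i) (initial i)
  pair-initial-overlap {i} i<K =
    overlap⁺ (∈pair⁺ (inj₁ (toℕ-fromℕ< x<))) (∈initial⁺ (ℕ.≤-reflexive (toℕ-fromℕ< x<)))
             (∈pair⁺ (inj₂ (toℕ-fromℕ< y<)))
             (λ y∈ → 1+n≰n (subst (_≤ suc i) (toℕ-fromℕ< y<) (∈initial⁻ y∈)))
             (∈initial⁺ {i} {zero} z≤n) (∉pair (inj₁ (s≤s z≤n)))
    where
    y< : 2 + i < 2 + K
    y< = s≤s (s≤s i<K)
    x< : 1 + i < 2 + K
    x< = <-trans (ℕ.n<1+n _) y<

  initial-¬overlap : ∀ {i j} → ¬ Overlap (initial i) (initial j)
  initial-¬overlap {i} {j} (_ , i⊈j , j⊈i) with ℕ.≤-total i j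
  ... | inj₁ i≤j = i⊈j (λ x∈ → ∈initial⁺ (≤-trans (∈initial⁻ x∈) (s≤s i≤j)))
  ... | inj₂ j≤i = j⊈i (λ x∈ → ∈initial⁺ (≤-trans (∈initial⁻ x∈) (s≤s j≤i)))

⊆-⋃ : ∀ {m N} (S : Fin N → Subset m) v → S v ⊆ ⋃ (List.tabulate S)
⊆-⋃ S zero    = p⊆p∪q _
⊆-⋃ S (suc v) = λ x∈ → q⊆p∪q (S zero) _ (⊆-⋃ (S ∘ suc) v x∈)

rep-path-size : ∀ {n m} {G : Graph n} {S : Fin n → Subset m} → IsOverlapRep G S →
                ∀ k {q : ℕ → Fin n} → IsPath (λ i j → Adj G (q i) (q j)) (3 + k) → 3 + k ≤ repSize S
rep-path-size {S = S} rep k {q} P = path-size k P′ (λ {l} _ → ⊆-⋃ S (q l))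
  where
  P′ : OverlapPath (3 + k) (S ∘ q)
  P′ = record
    { edge⇒adjacent = λ i< j< ov → edge⇒adjacent P i< j< (Equivalence.from (rep _ _) ov)
    ; adjacent⇒edge = λ i+1< → Equivalence.to (rep _ _) (adjacent⇒edge P i+1<)
    }

module Caterpillar {n k : ℕ} (T : Graph n) (connected : Connected T)
                   (p : Fin (suc k) → Fin n) (spine : IsSpine T (suc k) p) where

  K : ℕ
  K = suc k

  p-injective : Injective _≡_ _≡_ p
  p-injective = proj₁ (proj₁ spine)

  p-adjacent⇔ : ∀ i j → Adj T (p i) (p j) ⇔ (suc (toℕ i) ≡ toℕ j ⊎ suc (toℕ j) ≡ toℕ i)
  p-adjacent⇔ = proj₂ (proj₁ spine)

  OnSpine : Fin n → Set
  OnSpine v = ∃[ i ] p i ≡ v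

  onSpine? : Decidable OnSpine
  onSpine? v = any? (λ i → p i ≟ v)

  nonLeaf⇔onSpine : ∀ v → NonLeaf T v ⇔ OnSpine v
  nonLeaf⇔onSpine = proj₂ spine

  leaf-neighbour-unique : ∀ {v x y} → ¬ OnSpine v → Adj T v x → Adj T v y → x ≡ y
  leaf-neighbour-unique {v} {x} {y} v∉ vx vy with x ≟ y
  ... | yes x≡y = x≡y
  ... | no x≢y = ⊥-elim (v∉ (Equivalence.to (nonLeaf⇔onSpine v) (x , y , x≢y , vx , vy)))

  leaf-edge-closed : ∀ {u v} → ¬ OnSpine u → ¬ OnSpine v → Adj T u v →
                     ∀ {x y} → Reach T x y → x ≡ u ⊎ x ≡ v → y ≡ u ⊎ y ≡ v
  leaf-edge-closed u∉ v∉ uv here x∈uv = x∈uv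
  leaf-edge-closed u∉ v∉ uv (step xw w↝y) (inj₁ refl) =
    leaf-edge-closed u∉ v∉ uv w↝y (inj₂ (leaf-neighbour-unique u∉ xw uv))
  leaf-edge-closed u∉ v∉ uv (step xw w↝y) (inj₂ refl) =
    leaf-edge-closed u∉ v∉ uv w↝y (inj₁ (leaf-neighbour-unique v∉ xw (Graph.sym T uv)))

  leaves-nonadjacent : ∀ {u v} → ¬ OnSpine u → ¬ OnSpine v → ¬ Adj T u v
  leaves-nonadjacent u∉ v∉ uv with leaf-edge-closed u∉ v∉ uv (connected _ (p zero)) (inj₁ refl)
  ... | inj₁ p₀≡u = u∉ (zero , p₀≡u)
  ... | inj₂ p₀≡v = v∉ (zero , p₀≡v)

  leaf⇒spine-neighbour : ∀ {v} → ¬ OnSpine v → ∃[ j ] Adj T v (p j)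
  leaf⇒spine-neighbour {v} v∉ with connected v (p zero)
  ... | here = ⊥-elim (v∉ (zero , refl))
  ... | step {w = w} vw _ with onSpine? w
  ...   | yes (j , refl) = j , vw
  ...   | no w∉ = ⊥-elim (leaves-nonadjacent v∉ w∉ vw)

  neighbour-avoiding : ∀ {v} {Bad : Fin n → Set} → Decidable Bad →
                       (∀ {x y} → Adj T v x → Adj T v y → Bad x → Bad y → x ≡ y) →
                       OnSpine v → ∃[ w ] Adj T v w × ¬ Bad w
  neighbour-avoiding {v} bad? bad-unique v∈ with Equivalence.from (nonLeaf⇔onSpine v) v∈
  ... | x , y , x≢y , vx , vy with bad? x | bad? y
  ...   | no x-good | _         = x , vx , x-good
  ...   | yes _     | no y-good = y , vy , y-good
  ...   | yes x-bad | yes y-bad = ⊥-elim (x≢y (bad-unique vx vy x-bad y-bad))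

  last : Fin K
  last = fromℕ k

  first-spine-neighbour : ∀ {j} → Adj T (p zero) (p j) → toℕ j ≡ 1
  first-spine-neighbour h with Equivalence.to (p-adjacent⇔ zero _) h
  ... | inj₁ 1≡j = sym 1≡j
  ... | inj₂ ()

  last-spine-neighbour : ∀ {j} → Adj T (p last) (p j) → suc (toℕ j) ≡ k
  last-spine-neighbour {j} h with Equivalence.to (p-adjacent⇔ last j) h
  ... | inj₁ k+1≡j = ⊥-elim (ℕ.<⇒≢ (toℕ<n j) (trans (sym k+1≡j) (cong suc (toℕ-fromℕ k))))
  ... | inj₂ j+1≡k = trans j+1≡k (toℕ-fromℕ k)

  leafˡ-exists : ∃[ a ] Adj T (p zero) a × ¬ OnSpine a
  leafˡ-exists = neighbour-avoiding onSpine? unique (zero , refl)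
    where
    unique : ∀ {x y} → Adj T (p zero) x → Adj T (p zero) y → OnSpine x → OnSpine y → x ≡ y
    unique hx hy (_ , refl) (_ , refl) =
      cong p (toℕ-injective (trans (first-spine-neighbour hx) (sym (first-spine-neighbour hy))))

  leafˡ : Fin n
  leafˡ = proj₁ leafˡ-exists

  leafˡ-adjacent : Adj T leafˡ (p zero)
  leafˡ-adjacent = Graph.sym T (proj₁ (proj₂ leafˡ-exists))

  leafˡ-leaf : ¬ OnSpine leafˡ
  leafˡ-leaf = proj₂ (proj₂ leafˡ-exists)

  leafˡ-neighbour : ∀ {i} → Adj T leafˡ (p i) → toℕ i ≡ 0
  leafˡ-neighbour h = cong toℕ (p-injective (leaf-neighbour-unique leafˡ-leaf h leafˡ-adjacent))

  leafʳ-exists : ∃[ b ] Adj T (p last) b × ¬ (OnSpine b ⊎ b ≡ leafˡ)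
  leafʳ-exists = neighbour-avoiding (λ x → onSpine? x ⊎-dec x ≟ leafˡ) unique (last , refl)
    where
    k≡0 : Adj T (p last) leafˡ → k ≡ 0
    k≡0 h = trans (sym (toℕ-fromℕ k)) (leafˡ-neighbour (Graph.sym T h))

    unique : ∀ {x y} → Adj T (p last) x → Adj T (p last) y →
             OnSpine x ⊎ x ≡ leafˡ → OnSpine y ⊎ y ≡ leafˡ → x ≡ y
    unique hx hy (inj₁ (_ , refl)) (inj₁ (_ , refl)) =
      cong p (toℕ-injective (ℕ.suc-injective
        (trans (last-spine-neighbour hx) (sym (last-spine-neighbour hy)))))
    unique hx hy (inj₁ (_ , refl)) (inj₂ refl) with () ← trans (last-spine-neighbour hx) (k≡0 hy)
    unique hx hy (inj₂ refl) (inj₁ (_ , refl)) with () ← trans (last-spine-neighbour hy) (k≡0 hx)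
    unique hx hy (inj₂ refl) (inj₂ refl) = refl

  leafʳ : Fin n
  leafʳ = proj₁ leafʳ-exists

  leafʳ-adjacent : Adj T leafʳ (p last)
  leafʳ-adjacent = Graph.sym T (proj₁ (proj₂ leafʳ-exists))

  leafʳ-leaf : ¬ OnSpine leafʳ
  leafʳ-leaf = λ leafʳ∈ → proj₂ (proj₂ leafʳ-exists) (inj₁ leafʳ∈)

  leafʳ-neighbour : ∀ {i} → Adj T leafʳ (p i) → toℕ i ≡ k
  leafʳ-neighbour h =
    trans (cong toℕ (p-injective (leaf-neighbour-unique leafʳ-leaf h leafʳ-adjacent))) (toℕ-fromℕ k)

  vertex : ℕ → Fin n
  vertex zero = leafˡ
  vertex (suc j) with j ℕ.<? K
  ... | yes j<K = p (fromℕ< j<K)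
  ... | no _    = leafʳ

  vertex-spine : ∀ {j} (j<K : j < K) → vertex (suc j) ≡ p (fromℕ< j<K)
  vertex-spine {j} j<K with j ℕ.<? K
  ... | yes _   = refl
  ... | no j≮K = ⊥-elim (j≮K j<K)

  vertex-end : vertex (suc K) ≡ leafʳ
  vertex-end with K ℕ.<? K
  ... | yes K<K = ⊥-elim (1+n≰n K<K)
  ... | no _    = refl

  data Position : ℕ → Set where
    at-start : Position 0
    at-spine : (i : Fin K) → Position (suc (toℕ i))
    at-end   : Position (suc K)

  position : ∀ {l} → l < 2 + K → Position l
  position {zero}  _ = at-start
  position {suc j} j+1<K+2 with j ℕ.<? K
  ... | yes j<K = subst (Position ∘ suc) (toℕ-fromℕ< j<K) (at-spine (fromℕ< j<K))
  ... | no j≮K with refl ← ℕ.≤-antisym (ℕ.≤-pred (ℕ.≤-pred j+1<K+2)) (ℕ.≮⇒≥ j≮K) = at-end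

  vertexAt : ∀ {l} → Position l → Fin n
  vertexAt at-start     = leafˡ
  vertexAt (at-spine i) = p i
  vertexAt at-end       = leafʳ

  vertex≡vertexAt : ∀ {l} (π : Position l) → vertex l ≡ vertexAt π
  vertex≡vertexAt at-start     = refl
  vertex≡vertexAt (at-spine i) = trans (vertex-spine (toℕ<n i)) (cong p (fromℕ<-toℕ i (toℕ<n i)))
  vertex≡vertexAt at-end       = vertex-end

  adjacent⇒consecutive : ∀ {l l′} (π : Position l) (π′ : Position l′) →
                         Adj T (vertexAt π) (vertexAt π′) → suc l ≡ l′ ⊎ suc l′ ≡ l
  adjacent⇒consecutive at-start     at-start     h = ⊥-elim (irref T h)
  adjacent⇒consecutive at-start     (at-spine i) h = inj₁ (cong suc (sym (leafˡ-neighbour h)))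
  adjacent⇒consecutive at-start     at-end       h = ⊥-elim (leaves-nonadjacent leafˡ-leaf leafʳ-leaf h)
  adjacent⇒consecutive (at-spine i) at-start     h = inj₂ (cong suc (sym (leafˡ-neighbour (Graph.sym T h))))
  adjacent⇒consecutive (at-spine i) (at-spine j) h =
    Data.Sum.map (cong suc) (cong suc) (Equivalence.to (p-adjacent⇔ i j) h)
  adjacent⇒consecutive (at-spine i) at-end       h = inj₁ (cong (2 +_) (leafʳ-neighbour (Graph.sym T h)))
  adjacent⇒consecutive at-end       at-start     h = ⊥-elim (leaves-nonadjacent leafʳ-leaf leafˡ-leaf h)
  adjacent⇒consecutive at-end       (at-spine j) h = inj₂ (cong (2 +_) (leafʳ-neighbour h))
  adjacent⇒consecutive at-end       at-end       h = ⊥-elim (irref T h)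

  consecutive⇒adjacent : ∀ {l} → suc l < 2 + K → Adj T (vertex l) (vertex (suc l))
  consecutive⇒adjacent {zero} _ = subst (Adj T leafˡ) (sym (vertex-spine (s≤s z≤n))) leafˡ-adjacent
  consecutive⇒adjacent {suc j} j+2<K+2 = by-cases (suc j ℕ.<? K)
    where
    j<K : j < K
    j<K = ℕ.≤-pred (ℕ.≤-pred j+2<K+2)

    by-cases : Dec (suc j < K) → Adj T (vertex (suc j)) (vertex (suc (suc j)))
    by-cases (yes j+1<K) =
      subst₂ (Adj T) (sym (vertex-spine j<K)) (sym (vertex-spine j+1<K))
             (Equivalence.from (p-adjacent⇔ _ _)
               (inj₁ (trans (cong suc (toℕ-fromℕ< j<K)) (sym (toℕ-fromℕ< j+1<K)))))
    by-cases (no j+1≮K) =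
      subst₂ (Adj T) (sym (trans (vertex-spine j<K) (cong p (toℕ-injective j≡last))))
             (sym (trans (cong (vertex ∘ suc) j+1≡K) vertex-end)) (Graph.sym T leafʳ-adjacent)
      where
      j+1≡K : suc j ≡ K
      j+1≡K = ℕ.≤-antisym j<K (ℕ.≮⇒≥ j+1≮K)
      j≡last : toℕ (fromℕ< j<K) ≡ toℕ last
      j≡last = trans (toℕ-fromℕ< j<K) (trans (ℕ.suc-injective j+1≡K) (sym (toℕ-fromℕ k)))

  path : IsPath (λ i j → Adj T (vertex i) (vertex j)) (2 + K)
  path = record
    { edge⇒adjacent = λ i< j< h →
        adjacent⇒consecutive (position i<) (position j<)
          (subst₂ (Adj T) (vertex≡vertexAt (position i<)) (vertex≡vertexAt (position j<)) h)
    ; adjacent⇒edge = consecutive⇒adjacent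
    }

  open SpineSets K

  spine-leaf : ∀ i {v} j → ¬ OnSpine v → Adj T v (p j) →
               Adj T (p i) v ⇔ Overlap (pair (toℕ i)) (initial (toℕ j))
  spine-leaf i j v∉ vj = mk⇔
    (λ h → subst (λ j → Overlap (pair (toℕ i)) (initial (toℕ j)))
                 (p-injective (leaf-neighbour-unique v∉ (Graph.sym T h) vj)) (pair-initial-overlap (toℕ<n i)))
    (λ ov → subst (λ i → Adj T (p i) _) (toℕ-injective (sym (pair-initial-overlap⇒ ov))) (Graph.sym T vj))

  attachment : ∀ {v} → ¬ OnSpine v → Fin K
  attachment v∉ = proj₁ (leaf⇒spine-neighbour v∉)

  setAt : ∀ v → Dec (OnSpine v) → Subset (2 + K)
  setAt v (yes (i , _)) = pair (toℕ i)
  setAt v (no v∉)       = initial (toℕ (attachment v∉))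

  represents : ∀ u v (u? : Dec (OnSpine u)) (v? : Dec (OnSpine v)) →
               Adj T u v ⇔ Overlap (setAt u u?) (setAt v v?)
  represents _ _ (yes (i , refl)) (yes (j , refl)) = mk⇔
    (λ h → pair-overlap⇐ (toℕ<n i) (toℕ<n j) (Equivalence.to (p-adjacent⇔ i j) h))
    (λ ov → Equivalence.from (p-adjacent⇔ i j) (pair-overlap⇒ ov))
  represents _ _ (yes (i , refl)) (no v∉) = spine-leaf i _ v∉ (proj₂ (leaf⇒spine-neighbour v∉))
  represents _ _ (no u∉) (yes (j , refl)) with spine-leaf j _ u∉ (proj₂ (leaf⇒spine-neighbour u∉))
  ... | ju⇔ = mk⇔ (λ h → overlap-sym (Equivalence.to ju⇔ (Graph.sym T h)))
                  (λ ov → Graph.sym T (Equivalence.from ju⇔ (overlap-sym ov)))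
  represents _ _ (no u∉) (no v∉) =
    mk⇔ (λ h → ⊥-elim (leaves-nonadjacent u∉ v∉ h))
        (λ ov → ⊥-elim (initial-¬overlap {toℕ (attachment u∉)} {toℕ (attachment v∉)} ov))

  sets : Fin n → Subset (2 + K)
  sets v = setAt v (onSpine? v)

  sets-represent : IsOverlapRep T sets
  sets-represent u v = represents u v (onSpine? u) (onSpine? v)

  size-bound : ∀ m (S : Fin n → Subset m) → IsOverlapRep T S → 2 + K ≤ repSize S
  size-bound _ S rep = rep-path-size {G = T} {S} rep k path

  sets-size : repSize sets ≡ 2 + K
  sets-size = ℕ.≤-antisym (∣p∣≤n (⋃ (List.tabulate sets))) (size-bound _ sets sets-represent)

corollary16 : ∀ {n : ℕ} (T : Graph n) (k : ℕ) → 1 ≤ k → CaterpillarWithSpine T k → OverlapNumber T (k + 2)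
corollary16 T (suc k) _ ((connected , _) , p , spine) rewrite ℕ.+-comm (suc k) 2 =
  (_ , sets , sets-represent , sets-size) , size-bound
  where open Caterpillar T connected p spine
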